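{- Let $G$ be an even-hole-free graph. Then for any two maximum independent sets $I_1,I_2$ of $G$, the induced subgraph $G[I_1\triangle I_2]$ is acyclic.
   Context: A hole is an induced cycle of length at least $4$; a graph is even-hole-free if it has no hole with an even number of vertices. $I_1\triangle I_2$ denotes the symmetric difference. -}

module Defs where

open import Data.Nat using (ℕ; zero; suc; _≤_; _%_)
open import Data.Nat.Divisibility using (_∣_)
open import Data.Bool using (Bool; true; false; _xor_)
open import Data.Vec using (zipWith)
open import Data.Fin using (Fin; toℕ)
open import Data.Fin.Subset using (Subset; _∈_; ∣_∣)
open import Data.Product using (Σ; _×_)
open import Data.Sum using (_⊎_)
open import Relation.Binary.PropositionalEquality using (_≡_)
open import Relation.Nullary using (¬_)
open import Function.Definitions using (Injective)

record Graph (n : ℕ) : Set where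
  field
    adj   : Fin n → Fin n → Bool
    sym   : ∀ u v → adj u v ≡ adj v u
    irrefl : ∀ u → adj u u ≡ false
open Graph public

Adj : ∀ {n} → Graph n → Fin n → Fin n → Set
Adj G u v = adj G u v ≡ true

CycAdj : ∀ m → Fin (suc m) → Fin (suc m) → Set
CycAdj m i j = (suc (toℕ i) % suc m ≡ toℕ j) ⊎ (suc (toℕ j) % suc m ≡ toℕ i)

record Cycle {n} (G : Graph n) (m : ℕ) : Set where
  field
    vert   : Fin (suc m) → Fin n
    length≥3 : 3 ≤ suc m
    distinct : Injective _≡_ _≡_ vert
    edges  : ∀ i j → CycAdj m i j → Adj G (vert i) (vert j)
open Cycle public

record Hole {n} (G : Graph n) (m : ℕ) : Set where
  field
    cycle   : Cycle G m
    length≥4 : 4 ≤ suc m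
    induced : ∀ i j → Adj G (vert cycle i) (vert cycle j) → CycAdj m i j
open Hole public

EvenHoleFree : ∀ {n} → Graph n → Set
EvenHoleFree G = ∀ m → Hole G m → ¬ (2 ∣ suc m)

Independent : ∀ {n} → Graph n → Subset n → Set
Independent G S = ∀ u v → u ∈ S → v ∈ S → adj G u v ≡ false

MaximumIndependent : ∀ {n} → Graph n → Subset n → Set
MaximumIndependent G S =
  Independent G S × (∀ T → Independent G T → ∣ T ∣ ≤ ∣ S ∣)

_△_ : ∀ {n} → Subset n → Subset n → Subset n
_△_ = zipWith _xor_

-- G[S] is acyclic: no cycle of G all of whose vertices lie in S
-- (a cycle of G[S] is exactly a cycle of G with all vertices in S).
InducedAcyclic : ∀ {n} → Graph n → Subset n → Set
InducedAcyclic G S = ∀ m (C : Cycle G m) → ¬ (∀ i → vert C i ∈ S)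

{-# OPTIONS --safe #-}
-- Since I₁ and I₂ are independent, G[I₁ △ I₂] is bipartite with sides I₁ ∖ I₂ and I₂ ∖ I₁, so
-- all its cycles are even. A shortest such cycle is chordless, since a chord would cut off a
-- shorter cycle; being even it has length at least 4, so it would be an even hole of G.
module Submission where

open import Defs
open import Data.Nat using (ℕ; zero; suc; _+_; _≤_; _<_; _%_; z≤n; s≤s)
open import Data.Nat.Properties using (_≟_; ≤-refl; ≤-trans; <⇒≤; ≤-total; m≤n⇒m<n∨m≡n; m+n≤o⇒n≤o; n≤0⇒n≡0; +-suc; +-comm; +-identityʳ; +-cancelˡ-≡; +-cancelʳ-≤; +-monoʳ-≤; m≤n⇒∃[o]m+o≡n)
open import Data.Nat.DivMod using (_mod_; n%n≡0; m≤n⇒m%n≡m)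
open import Data.Nat.Divisibility using (_∣_; _∣?_; _∣0; ∣-refl; ∣m∣n⇒∣m+n)
open import Data.Nat.Induction using (<-rec)
open import Data.Fin using (Fin; toℕ)
open import Data.Fin.Properties using (toℕ-injective; toℕ-fromℕ<; toℕ≤pred[n])
open import Data.Fin.Subset using (Subset; _∈_)
open import Data.Vec using (lookup)
open import Data.Vec.Properties using ([]=⇒lookup; lookup⇒[]=; lookup-zipWith)
open import Data.Bool using (Bool; true; false; not; _xor_)
open import Data.Bool.Properties using (not-involutive; not-¬)
open import Data.Product using (_×_; _,_)
open import Data.Sum using (_⊎_; inj₁; inj₂)
open import Data.Empty using (⊥; ⊥-elim)
open import Relation.Nullary using (¬_; yes; no)
open import Relation.Nullary.Decidable using (toWitnessFalse)
open import Relation.Binary.PropositionalEquality as ≡ using (_≡_; _≢_; refl; cong; subst)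

module _ {n : ℕ} (G : Graph n) where

  adj-sym : ∀ {u v} → Adj G u v → Adj G v u
  adj-sym {u} {v} uv = ≡.trans (sym G v u) uv

  adj-irrefl : ∀ {u} → ¬ Adj G u u
  adj-irrefl {u} uu with ≡.trans (≡.sym (irrefl G u)) uu
  ... | ()

  independent⇒¬adj : ∀ {S u v} → Independent G S → u ∈ S → v ∈ S → ¬ Adj G u v
  independent⇒¬adj ind u∈S v∈S uv with ≡.trans (≡.sym (ind _ _ u∈S v∈S)) uv
  ... | ()

ProperTwoColouring : ∀ {n} → Graph n → (Fin n → Set) → (Fin n → Bool) → Set
ProperTwoColouring G P c = ∀ {u v} → P u → P v → Adj G u v → c v ≡ not (c u)

∈△∧∉ˡ⇒∈ʳ : ∀ {n} {I₁ I₂ : Subset n} {v} → v ∈ I₁ △ I₂ → lookup I₁ v ≡ false → v ∈ I₂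
∈△∧∉ˡ⇒∈ʳ {I₁ = I₁} {I₂} {v} v∈△ v∉I₁ = lookup⇒[]= v I₂
  (subst (λ b → b xor lookup I₂ v ≡ true) v∉I₁
    (≡.trans (≡.sym (lookup-zipWith _xor_ v I₁ I₂)) ([]=⇒lookup v∈△)))

△-properTwoColouring : ∀ {n} {G : Graph n} {I₁ I₂ : Subset n} →
  Independent G I₁ → Independent G I₂ → ProperTwoColouring G (_∈ I₁ △ I₂) (lookup I₁)
△-properTwoColouring {G = G} {I₁} {I₂} ind₁ ind₂ {u} {v} u∈△ v∈△ uv
  with lookup I₁ u in u₁ | lookup I₁ v in v₁
... | true  | true  = ⊥-elim (independent⇒¬adj G ind₁ (lookup⇒[]= u I₁ u₁) (lookup⇒[]= v I₁ v₁) uv)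
... | true  | false = refl
... | false | true  = refl
... | false | false = ⊥-elim (independent⇒¬adj G ind₂ (∈△∧∉ˡ⇒∈ʳ u∈△ u₁) (∈△∧∉ˡ⇒∈ʳ v∈△ v₁) uv)

-- A cycle vertex 0, …, vertex m of length suc m with all vertices in P. Indexing by ℕ
-- (vertex is junk beyond m) makes shifting and shortening a cycle free of Fin arithmetic.
record Circuit {n} (G : Graph n) (P : Fin n → Set) (m : ℕ) : Set where
  field
    vertex    : ℕ → Fin n
    2≤m       : 2 ≤ m
    injective : ∀ {a b} → a ≤ m → b ≤ m → vertex a ≡ vertex b → a ≡ b
    step      : ∀ {k} → k < m → Adj G (vertex k) (vertex (suc k))
    closing   : Adj G (vertex m) (vertex 0)
    inside    : ∀ {k} → k ≤ m → P (vertex k)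

module _ {n} {G : Graph n} {P : Fin n → Set} {c : Fin n → Bool}
         (proper : ProperTwoColouring G P c) {m} (C : Circuit G P m) where
  open Circuit C

  colour-flips : ∀ {k} → k < m → c (vertex (suc k)) ≡ not (c (vertex k))
  colour-flips k<m = proper (inside (<⇒≤ k<m)) (inside k<m) (step k<m)

  colour-alternates : ∀ k → k ≤ m →
    c (vertex k) ≡ c (vertex 0) × 2 ∣ k ⊎ c (vertex k) ≡ not (c (vertex 0)) × 2 ∣ suc k
  colour-alternates zero    _   = inj₁ (refl , 2 ∣0)
  colour-alternates (suc k) k<m with colour-alternates k (<⇒≤ k<m)
  ... | inj₁ (same , 2∣k) =
    inj₂ (≡.trans (colour-flips k<m) (cong not same) , ∣m∣n⇒∣m+n ∣-refl 2∣k)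
  ... | inj₂ (flipped , 2∣1+k) =
    inj₁ (≡.trans (colour-flips k<m) (≡.trans (cong not flipped) (not-involutive _)) , 2∣1+k)

  circuit-length-even : 2 ∣ suc m
  circuit-length-even with colour-alternates m ≤-refl
  ... | inj₁ (same , _)   = ⊥-elim (not-¬ (≡.sym same) (proper (inside ≤-refl) (inside z≤n) closing))
  ... | inj₂ (_ , 2∣1+m) = 2∣1+m

even⇒length≥4 : ∀ {m} → 2 ≤ m → 2 ∣ suc m → 4 ≤ suc m
even⇒length≥4 2≤m 2∣1+m with m≤n⇒m<n∨m≡n 2≤m
... | inj₁ 2<m  = s≤s 2<m
... | inj₂ refl = ⊥-elim (toWitnessFalse {a? = 2 ∣? 3} _ 2∣1+m)

chord-length< : ∀ {a d m} → a + d ≤ m → suc (a + d) % suc m ≢ a → d < m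
chord-length< {a} {d} {m} a+d≤m not-prev with m≤n⇒m<n∨m≡n (m+n≤o⇒n≤o a a+d≤m)
... | inj₁ d<m  = d<m
... | inj₂ refl with n≤0⇒n≡0 (+-cancelʳ-≤ d a 0 a+d≤m)
...   | refl = ⊥-elim (not-prev (n%n≡0 (suc d)))

module _ {n} {G : Graph n} {P : Fin n → Set} {m} (C : Circuit G P m) where
  open Circuit C

  shortcut : ∀ a d → 2 ≤ d → a + d ≤ m → Adj G (vertex a) (vertex (a + d)) → Circuit G P d
  shortcut a d 2≤d a+d≤m chord = record
    { vertex    = λ k → vertex (a + k)
    ; 2≤m       = 2≤d
    ; injective = λ {x} {y} x≤d y≤d eq → +-cancelˡ-≡ a x y (injective (within x≤d) (within y≤d) eq)
    ; step      = λ {k} k<d → subst (λ j → Adj G (vertex (a + k)) (vertex j)) (≡.sym (+-suc a k))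
                                (step (subst (_≤ m) (+-suc a k) (within k<d)))
    ; closing   = subst (λ j → Adj G (vertex (a + d)) (vertex j)) (≡.sym (+-identityʳ a)) (adj-sym G chord)
    ; inside    = λ k≤d → inside (within k≤d)
    }
    where
    within : ∀ {k} → k ≤ d → a + k ≤ m
    within k≤d = ≤-trans (+-monoʳ-≤ a k≤d) a+d≤m

  consecutive⇒adj : ∀ {a b} → a ≤ m → suc a % suc m ≡ b → Adj G (vertex a) (vertex b)
  consecutive⇒adj {a} a≤m refl with m≤n⇒m<n∨m≡n a≤m
  ... | inj₁ a<m  = subst (λ j → Adj G (vertex a) (vertex j)) (≡.sym (m≤n⇒m%n≡m a<m)) (step a<m)
  ... | inj₂ refl = subst (λ j → Adj G (vertex m) (vertex j)) (≡.sym (n%n≡0 (suc m))) closing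

  circuit⇒cycle : Cycle G m
  circuit⇒cycle = record
    { vert     = λ i → vertex (toℕ i)
    ; length≥3 = s≤s 2≤m
    ; distinct = λ {i} {j} eq → toℕ-injective (injective (toℕ≤pred[n] i) (toℕ≤pred[n] j) eq)
    ; edges    = edges′
    }
    where
    edges′ : ∀ i j → CycAdj m i j → Adj G (vertex (toℕ i)) (vertex (toℕ j))
    edges′ i j (inj₁ i→j) = consecutive⇒adj (toℕ≤pred[n] i) i→j
    edges′ i j (inj₂ j→i) = adj-sym G (consecutive⇒adj (toℕ≤pred[n] j) j→i)

  module _ (minimal : ∀ {d} → d < m → ¬ Circuit G P d) where

    no-chord-of-length : ∀ a d → a + d ≤ m → Adj G (vertex a) (vertex (a + d)) →
      suc a % suc m ≢ a + d → suc (a + d) % suc m ≢ a → ⊥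
    no-chord-of-length a zero _ chord _ _ =
      adj-irrefl G (subst (λ j → Adj G (vertex a) (vertex j)) (+-identityʳ a) chord)
    no-chord-of-length a (suc zero) a+1≤m _ not-next _ =
      not-next (≡.trans (m≤n⇒m%n≡m (subst (_≤ m) (+-comm a 1) a+1≤m)) (≡.sym (+-comm a 1)))
    no-chord-of-length a d@(suc (suc _)) a+d≤m chord _ not-prev =
      minimal (chord-length< a+d≤m not-prev) (shortcut a d (s≤s (s≤s z≤n)) a+d≤m chord)

    no-forward-chord : ∀ {a b} → a ≤ b → b ≤ m → Adj G (vertex a) (vertex b) →
      suc a % suc m ≢ b → suc b % suc m ≢ a → ⊥
    no-forward-chord {a} a≤b with m≤n⇒∃[o]m+o≡n a≤b
    ... | d , refl = no-chord-of-length a d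

    minimal-circuit-induced : ∀ i j → Adj G (vertex (toℕ i)) (vertex (toℕ j)) → CycAdj m i j
    minimal-circuit-induced i j chord
      with suc (toℕ i) % suc m ≟ toℕ j | suc (toℕ j) % suc m ≟ toℕ i | ≤-total (toℕ i) (toℕ j)
    ... | yes i→j | _       | _        = inj₁ i→j
    ... | no _    | yes j→i | _        = inj₂ j→i
    ... | no i↛j  | no j↛i  | inj₁ i≤j =
      ⊥-elim (no-forward-chord i≤j (toℕ≤pred[n] j) chord i↛j j↛i)
    ... | no i↛j  | no j↛i  | inj₂ j≤i =
      ⊥-elim (no-forward-chord j≤i (toℕ≤pred[n] i) (adj-sym G chord) j↛i i↛j)

    minimal-circuit⇒hole : 4 ≤ suc m → Hole G m
    minimal-circuit⇒hole 4≤1+m = record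
      { cycle    = circuit⇒cycle
      ; length≥4 = 4≤1+m
      ; induced  = minimal-circuit-induced
      }

cycle⇒circuit : ∀ {n} {G : Graph n} {P : Fin n → Set} {m} (C : Cycle G m) →
  (∀ i → P (vert C i)) → Circuit G P m
cycle⇒circuit {m = m} C inP = record
  { vertex    = λ k → vert C (k mod suc m)
  ; 2≤m       = 2≤m (length≥3 C)
  ; injective = λ {a} {b} a≤m b≤m eq →
      ≡.trans (≡.sym (toℕ-mod a≤m)) (≡.trans (cong toℕ (distinct C eq)) (toℕ-mod b≤m))
  ; step      = λ k<m → edges C _ _ (inj₁ (≡.trans (next-mod (<⇒≤ k<m)) (≡.sym (toℕ-fromℕ< _))))
  ; closing   = edges C _ _ (inj₁ (≡.trans (next-mod ≤-refl) (n%n≡0 (suc m))))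
  ; inside    = λ {k} _ → inP (k mod suc m)
  }
  where
  2≤m : 3 ≤ suc m → 2 ≤ m
  2≤m (s≤s 2≤m) = 2≤m
  toℕ-mod : ∀ {k} → k ≤ m → toℕ (k mod suc m) ≡ k
  toℕ-mod k≤m = ≡.trans (toℕ-fromℕ< _) (m≤n⇒m%n≡m k≤m)
  next-mod : ∀ {k} → k ≤ m → suc (toℕ (k mod suc m)) % suc m ≡ suc k % suc m
  next-mod k≤m = cong (λ x → suc x % suc m) (toℕ-mod k≤m)

module _ {n} {G : Graph n} (ehf : EvenHoleFree G) {P : Fin n → Set} {c : Fin n → Bool}
         (proper : ProperTwoColouring G P c) where

  evenHoleFree⇒no-properly-coloured-circuit : ∀ m → ¬ Circuit G P m
  evenHoleFree⇒no-properly-coloured-circuit = <-rec _ λ m minimal C →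
    let even = circuit-length-even proper C
    in ehf m (minimal-circuit⇒hole C minimal (even⇒length≥4 (Circuit.2≤m C) even)) even

lemma3p2 : ∀ {n : ℕ} (G : Graph n) → EvenHoleFree G →
    ∀ (I₁ I₂ : Subset n) → MaximumIndependent G I₁ → MaximumIndependent G I₂ →
    InducedAcyclic G (I₁ △ I₂)
lemma3p2 G ehf I₁ I₂ (ind₁ , _) (ind₂ , _) m C inside =
  evenHoleFree⇒no-properly-coloured-circuit ehf (△-properTwoColouring {G = G} {I₁} {I₂} ind₁ ind₂) m
    (cycle⇒circuit C inside)
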